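{- Let $A=(\alpha_1,\dots,\alpha_q)$ with $q\ge1$ and all $\alpha_i\ge2$ integers, and let $d(A)=\alpha_1+\dots+\alpha_q-q$. Then \[d(A)+1\le D(A)\le f_{d(A)+1}.\] Equality holds on the left if and only if $q=1$ or $A=(2,2,\dots,2)$; equality holds on the right if and only if $\alpha_1\le3$, $\alpha_q\le3$ and $\alpha_2=\dots=\alpha_{q-1}=3$.
   Context: $f_0=f_1=1$, $f_i=f_{i-1}+f_{i-2}$ ($i\ge2$). The integers $D(\alpha_1,\dots,\alpha_r)$ are defined by $D(\emptyset)=1$, $D(\alpha_1)=\alpha_1$, and $D(\alpha_1,\dots,\alpha_r)=\alpha_rD(\alpha_1,\dots,\alpha_{r-1})-D(\alpha_1,\dots,\alpha_{r-2})$ for $r\ge2$. -}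

module Defs where

open import Data.Nat using (ℕ; zero; suc; _+_)
open import Data.Integer using (ℤ; +_; _-_; _*_)
open import Data.List using (List; []; _∷_)

fib : ℕ → ℕ
fib zero = 1
fib (suc zero) = 1
fib (suc (suc n)) = fib (suc n) + fib n

-- Dpair (α₁,…,αᵣ) = (D(α₁,…,αᵣ), D(α₁,…,αᵣ₋₁)), computed left to right.
-- Convention D of the "length -1" prefix is 0, so that D(α₁) = α₁·D(∅) - 0 = α₁,
-- and for r ≥ 2: D(α₁..αᵣ) = αᵣ D(α₁..αᵣ₋₁) - D(α₁..αᵣ₋₂).
Dgo : ℤ → ℤ → List ℕ → ℤ
Dgo cur prev [] = cur
Dgo cur prev (a ∷ as) = Dgo (+ a * cur - prev) cur as

D : List ℕ → ℤ
D as = Dgo (+ 1) (+ 0) as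

-- Write αᵢ = 2 + bᵢ and track the current value c = D(α₁,…,αᵣ) together with the increment
-- e = c − D(α₁,…,αᵣ₋₁).  Reading α = 2 + b sends (c, e) to (c + e′, e′) with e′ = b·c + e,
-- starting from (1, 1), so the recurrence lives in ℕ and is monotone in (c, e).
-- Lower bound: for c, e ≥ 1 a step raises c by e′ ≥ b + 1 = α − 1, with equality iff e = 1
-- and (b = 0 or c = 1); after the first step c ≥ 2, and e stays 1 only while b = 0.
-- Upper bound: compare with the Fibonacci state (f_{m+1}, f_m).  As b·f_{m+1} + f_m ≤ f_{m+b+1},
-- reading b from that state lands below the Fibonacci state of index m + b + 1: strictly in c
-- when α ≥ 4, and strictly in e when α = 2 and m ≥ 1, which makes the final bound strict as
-- soon as a further entry is read.

module Submission where

open import Defs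
open import Data.Nat as ℕ using (ℕ; zero; suc; _+_; _*_; _∸_; _≤_; _<_; z≤n; s≤s)
open import Data.Nat.Properties
open import Data.Nat.Tactic.RingSolver using (solve-∀)
open import Data.Integer using (+_; _⊖_; +≤+) renaming (_≤_ to _≤ℤ_)
import Data.Integer as ℤ
import Data.Integer.Properties as ℤ
open import Data.Fin using (Fin; toℕ; zero; suc)
open import Data.Vec using (Vec; []; _∷_; toList; head; tail; last; lookup; map; sum)
open import Data.Vec.Relation.Unary.All using (All; []; _∷_)
open import Data.Vec.Relation.Unary.All.Properties using (lookup⁺; lookup⁻)
open import Data.Product using (_×_; _,_; proj₁; proj₂; ∃-syntax)
open import Data.Sum using (_⊎_; inj₁; inj₂)
open import Data.Sum.Function.Propositional using (_⊎-⇔_)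
open import Data.Unit using (⊤; tt)
open import Function using (_∘_)
open import Function.Bundles using (_⇔_; mk⇔; Equivalence)
open import Function.Properties.Equivalence using () renaming (refl to ⇔-refl; trans to ⇔-trans)
open import Relation.Nullary using (contradiction)
open import Relation.Binary.PropositionalEquality

private
  variable
    b c c′ e e′ g m n x : ℕ

fib-pos : ∀ n → 0 < fib n
fib-pos zero          = s≤s z≤n
fib-pos (suc zero)    = s≤s z≤n
fib-pos (suc (suc n)) = ≤-trans (fib-pos (suc n)) (m≤m+n _ _)

fib-≤-suc : ∀ n → fib n ≤ fib (suc n)
fib-≤-suc zero    = ≤-refl
fib-≤-suc (suc n) = m≤m+n _ _

fib-<-suc : ∀ n → fib (suc n) < fib (suc (suc n))
fib-<-suc n = m<m+n (fib (suc n)) (fib-pos n)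

fib-mono-+ : ∀ k n → fib n ≤ fib (k + n)
fib-mono-+ zero    n = ≤-refl
fib-mono-+ (suc k) n = ≤-trans (fib-mono-+ k n) (fib-≤-suc (k + n))

fib-linear : ∀ b m → b * fib (suc m) + fib m ≤ fib (b + suc m)
fib-linear zero          m = fib-≤-suc m
fib-linear (suc zero)    m = ≤-reflexive (cong (_+ fib m) (+-identityʳ (fib (suc m))))
fib-linear (suc (suc b)) m = begin
  (2 + b) * fib (suc m) + fib m              ≡⟨ +-assoc (fib (suc m)) _ (fib m) ⟩
  fib (suc m) + ((1 + b) * fib (suc m) + fib m)
    ≤⟨ +-mono-≤ (fib-mono-+ b (suc m)) (fib-linear (suc b) m) ⟩
  fib (b + suc m) + fib (1 + b + suc m)      ≡⟨ +-comm (fib (b + suc m)) _ ⟩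
  fib (2 + b + suc m)                        ∎
  where open ≤-Reasoning

fib-linear-< : ∀ b m → (3 + b) * fib (suc m) + fib m < fib (3 + b + suc m)
fib-linear-< zero m = begin-strict
  3 * fib (suc m) + fib m            <⟨ m<m+n _ (fib-pos m) ⟩
  3 * fib (suc m) + fib m + fib m    ≡⟨ unfold (fib (suc m)) (fib m) ⟩
  fib (3 + suc m)                    ∎
  where
  open ≤-Reasoning
  unfold : ∀ x y → 3 * x + y + y ≡ x + y + x + (x + y)
  unfold = solve-∀
fib-linear-< (suc b) m = begin-strict
  (4 + b) * fib (suc m) + fib m                 ≡⟨ +-assoc (fib (suc m)) _ (fib m) ⟩
  fib (suc m) + ((3 + b) * fib (suc m) + fib m)
    <⟨ +-mono-≤-< (fib-mono-+ (2 + b) (suc m)) (fib-linear-< b m) ⟩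
  fib (2 + b + suc m) + fib (3 + b + suc m)     ≡⟨ +-comm (fib (2 + b + suc m)) _ ⟩
  fib (4 + b + suc m)                           ∎
  where open ≤-Reasoning

ThreesThen≤3 : Vec ℕ n → Set
ThreesThen≤3 []           = ⊤
ThreesThen≤3 (x ∷ [])     = x ≤ 3
ThreesThen≤3 (x ∷ y ∷ ys) = x ≡ 3 × ThreesThen≤3 (y ∷ ys)

ThreesThen≤3-head : {xs : Vec ℕ n} → ThreesThen≤3 (x ∷ xs) → x ≤ 3
ThreesThen≤3-head {xs = []}    x≤3        = x≤3
ThreesThen≤3-head {xs = _ ∷ _} (refl , _) = ≤-refl

ThreesThen≤3-3∷ : {xs : Vec ℕ n} → ThreesThen≤3 xs ⇔ ThreesThen≤3 (3 ∷ xs)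
ThreesThen≤3-3∷ {xs = []}    = mk⇔ (λ _ → ≤-refl) (λ _ → tt)
ThreesThen≤3-3∷ {xs = _ ∷ _} = mk⇔ (refl ,_) proj₂

ThreesThen≤3⇔ : (xs : Vec ℕ (suc n)) →
                ThreesThen≤3 xs ⇔ (last xs ≤ 3 × (∀ i → toℕ i < n → lookup xs i ≡ 3))
ThreesThen≤3⇔ (x ∷ [])     = mk⇔ (λ x≤3 → x≤3 , λ _ ()) proj₁
ThreesThen≤3⇔ (x ∷ y ∷ ys) = mk⇔
  (λ { (refl , t) → let l , i = Equivalence.to (ThreesThen≤3⇔ (y ∷ ys)) t
                    in l , λ { zero _ → refl ; (suc j) (s≤s j<) → i j j< } })
  (λ { (l , i) → i zero (s≤s z≤n)
                , Equivalence.from (ThreesThen≤3⇔ (y ∷ ys)) (l , λ j j< → i (suc j) (s≤s j<)) })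

head-ThreesThen≤3-tail⇔ : (A : Vec ℕ (suc n)) →
  (head A ≤ 3 × ThreesThen≤3 (tail A))
    ⇔ (head A ≤ 3 × last A ≤ 3
        × (∀ (i : Fin (suc n)) → 0 < toℕ i → toℕ i < n → lookup A i ≡ 3))
head-ThreesThen≤3-tail⇔ (x ∷ []) =
  mk⇔ (λ (x≤3 , _) → x≤3 , x≤3 , λ _ _ ()) (λ (x≤3 , _) → x≤3 , tt)
head-ThreesThen≤3-tail⇔ (x ∷ y ∷ ys) = mk⇔
  (λ (x≤3 , t) → let l , i = Equivalence.to (ThreesThen≤3⇔ (y ∷ ys)) t
                 in x≤3 , l , λ { zero () _ ; (suc j) _ (s≤s j<) → i j j< })
  (λ (x≤3 , l , i) → x≤3 , Equivalence.from (ThreesThen≤3⇔ (y ∷ ys))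
                                              (l , λ j j< → i (suc j) (s≤s z≤n) (s≤s j<)))

-- D continued from the current value c and the previous value c ∸ e, reading the entries 2 + b.
Dℕ : ℕ → ℕ → Vec ℕ n → ℕ
Dℕ c e []       = c
Dℕ c e (b ∷ bs) = Dℕ (c + (b * c + e)) (b * c + e) bs

Dgo-step : ∀ b p e → + (2 + b) ℤ.* + (p + e) ℤ.- + p ≡ + (p + e + (b * (p + e) + e))
Dgo-step b p e = begin
  + (2 + b) ℤ.* + (p + e) ℤ.- + p     ≡⟨ cong (ℤ._- + p) (ℤ.pos-* (2 + b) (p + e)) ⟨
  + ((2 + b) * (p + e)) ℤ.- + p       ≡⟨ cong (λ y → + y ℤ.- + p) (expand b p e) ⟩
  + (p + X) ℤ.- + p                   ≡⟨ ℤ.m-n≡m⊖n (p + X) p ⟩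
  (p + X) ⊖ p                         ≡⟨ ℤ.⊖-≥ (m≤m+n p X) ⟩
  + (p + X ∸ p)                       ≡⟨ cong (λ x → + x) (m+n∸m≡n p X) ⟩
  + X                                 ∎
  where
  open ≡-Reasoning
  X : ℕ
  X = p + e + (b * (p + e) + e)
  expand : ∀ b p e → (2 + b) * (p + e) ≡ p + (p + e + (b * (p + e) + e))
  expand = solve-∀

Dgo≡Dℕ : ∀ p e (B : Vec ℕ n) →
         Dgo (+ (p + e)) (+ p) (toList (map (2 ℕ.+_) B)) ≡ + Dℕ (p + e) e B
Dgo≡Dℕ p e []      = refl
Dgo≡Dℕ p e (b ∷ B) =
  trans (cong (λ y → Dgo y (+ (p + e)) (toList (map (2 ℕ.+_) B))) (Dgo-step b p e))
        (Dgo≡Dℕ (p + e) (b * (p + e) + e) B)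

D≡Dℕ : (B : Vec ℕ n) → D (toList (map (2 ℕ.+_) B)) ≡ + Dℕ 1 1 B
D≡Dℕ = Dgo≡Dℕ 0 1

sum-map-2+ : (B : Vec ℕ n) → sum (map (2 ℕ.+_) B) ≡ n + sum (map suc B)
sum-map-2+ []                = refl
sum-map-2+ {suc n} (b ∷ B) = trans (cong (λ s → 2 + b + s) (sum-map-2+ B)) (shuffle b n _)
  where
  shuffle : ∀ b n s → 2 + b + (n + s) ≡ suc n + (suc b + s)
  shuffle = solve-∀

sum-map-2+∸length : (B : Vec ℕ n) → sum (map (2 ℕ.+_) B) ∸ n ≡ sum (map suc B)
sum-map-2+∸length {n} B = trans (cong (_∸ n) (sum-map-2+ B)) (m+n∸m≡n n _)

excesses : {A : Vec ℕ n} → All (2 ≤_) A → ∃[ B ] map (2 ℕ.+_) B ≡ A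
excesses []        = [] , refl
excesses (2≤a ∷ h) with m≤n⇒∃[o]m+o≡n 2≤a | excesses h
... | b , refl | B , refl = b ∷ B , refl

*-+-mono-≤ : ∀ b → c ≤ c′ → e ≤ e′ → b * c + e ≤ b * c′ + e′
*-+-mono-≤ b c≤c′ e≤e′ = +-mono-≤ (*-monoʳ-≤ b c≤c′) e≤e′

Dℕ-mono-≤ : c ≤ c′ → e ≤ e′ → (B : Vec ℕ n) → Dℕ c e B ≤ Dℕ c′ e′ B
Dℕ-mono-≤ c≤c′ e≤e′ []      = c≤c′
Dℕ-mono-≤ c≤c′ e≤e′ (b ∷ B) =
  Dℕ-mono-≤ (+-mono-≤ c≤c′ (*-+-mono-≤ b c≤c′ e≤e′)) (*-+-mono-≤ b c≤c′ e≤e′) B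

Dℕ-mono-<-≤ : c < c′ → e ≤ e′ → (B : Vec ℕ n) → Dℕ c e B < Dℕ c′ e′ B
Dℕ-mono-<-≤ c<c′ e≤e′ []      = c<c′
Dℕ-mono-<-≤ c<c′ e≤e′ (b ∷ B) =
  Dℕ-mono-<-≤ (+-mono-<-≤ c<c′ (*-+-mono-≤ b (<⇒≤ c<c′) e≤e′))
              (*-+-mono-≤ b (<⇒≤ c<c′) e≤e′) B

Dℕ-mono-≤-< : c ≤ c′ → e < e′ → ∀ b (B : Vec ℕ n) → Dℕ c e (b ∷ B) < Dℕ c′ e′ (b ∷ B)
Dℕ-mono-≤-< c≤c′ e<e′ b B =
  Dℕ-mono-<-≤ (+-mono-≤-< c≤c′ (+-mono-≤-< (*-monoʳ-≤ b c≤c′) e<e′))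
              (+-mono-≤ (*-monoʳ-≤ b c≤c′) (<⇒≤ e<e′)) B

step-gain : ∀ b → 1 ≤ c → 1 ≤ e → suc b ≤ b * c + e
step-gain {c = c@(suc _)} b _ 1≤e =
  ≤-trans (≤-reflexive (+-comm 1 b)) (+-mono-≤ (m≤m*n b c) 1≤e)

step-gain-<-by-e : ∀ b → 1 ≤ c → 2 ≤ e → suc b < b * c + e
step-gain-<-by-e {c = c@(suc _)} b _ 2≤e =
  ≤-trans (≤-reflexive (+-comm 2 b)) (+-mono-≤ (m≤m*n b c) 2≤e)

step-gain-<-by-c : ∀ k → 2 ≤ c → 1 ≤ e → 2 + k < suc k * c + e
step-gain-<-by-c k 2≤c 1≤e =
  ≤-trans (≤-trans (m≤m+n (3 + k) k) (≤-reflexive (double k))) (*-+-mono-≤ (suc k) 2≤c 1≤e)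
  where
  double : ∀ k → 3 + k + k ≡ suc k * 2 + 1
  double = solve-∀

Dℕ-lower : 1 ≤ c → 1 ≤ e → (B : Vec ℕ n) → c + sum (map suc B) ≤ Dℕ c e B
Dℕ-lower-step : 1 ≤ c → 1 ≤ e → ∀ b → g ≤ b * c + e → (B : Vec ℕ n) →
                c + (g + sum (map suc B)) ≤ Dℕ c e (b ∷ B)

Dℕ-lower {c = c} _   _   []      = ≤-reflexive (+-identityʳ c)
Dℕ-lower         1≤c 1≤e (b ∷ B) = Dℕ-lower-step 1≤c 1≤e b (step-gain b 1≤c 1≤e) B

Dℕ-lower-step {c = c} {e = e} {g = g} 1≤c 1≤e b g≤ B = begin
  c + (g + sum (map suc B))       ≡⟨ +-assoc c g _ ⟨
  c + g + sum (map suc B)         ≤⟨ +-monoˡ-≤ _ (+-monoʳ-≤ c g≤) ⟩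
  c + (b * c + e) + sum (map suc B)
    ≤⟨ Dℕ-lower (≤-trans 1≤c (m≤m+n c _)) (≤-trans 1≤e (m≤n+m e _)) B ⟩
  Dℕ c e (b ∷ B)                  ∎
  where open ≤-Reasoning

Dℕ-lower-< : 1 ≤ c → 1 ≤ e → ∀ b → suc b < b * c + e → (B : Vec ℕ n) →
             c + sum (map suc (b ∷ B)) < Dℕ c e (b ∷ B)
Dℕ-lower-< {c = c} {e = e} 1≤c 1≤e b gain B =
  subst (_≤ Dℕ c e (b ∷ B)) (+-suc c (suc b + sum (map suc B)))
        (Dℕ-lower-step 1≤c 1≤e b gain B)

Dℕ-lower-tight⇐ : (B : Vec ℕ n) → All (_≡ 2) (map (2 ℕ.+_) B) →
                  Dℕ c 1 B ≡ c + sum (map suc B)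
Dℕ-lower-tight⇐ {c = c} []      []         = sym (+-identityʳ c)
Dℕ-lower-tight⇐ {c = c} (0 ∷ B) (refl ∷ h) = trans (Dℕ-lower-tight⇐ B h) (+-assoc c 1 _)

Dℕ-lower-tight⇒ : 2 ≤ c → (B : Vec ℕ n) → Dℕ c 1 B ≡ c + sum (map suc B) →
                  All (_≡ 2) (map (2 ℕ.+_) B)
Dℕ-lower-tight⇒ _ [] _ = []
Dℕ-lower-tight⇒ {c = c} 2≤c (0 ∷ B) eq =
  refl ∷ Dℕ-lower-tight⇒ (≤-trans 2≤c (m≤m+n c 1)) B (trans eq (sym (+-assoc c 1 _)))
Dℕ-lower-tight⇒ 2≤c (suc k ∷ B) eq = contradiction eq (>⇒≢
  (Dℕ-lower-< (≤-trans (s≤s z≤n) 2≤c) ≤-refl (suc k) (step-gain-<-by-c k 2≤c ≤-refl) B))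

Dℕ-lower-tight : (B : Vec ℕ (suc n)) →
                 Dℕ 1 1 B ≡ suc (sum (map suc B)) ⇔ (suc n ≡ 1 ⊎ All (_≡ 2) (map (2 ℕ.+_) B))
Dℕ-lower-tight (b ∷ []) = mk⇔ (λ _ → inj₁ refl) (λ _ → single b)
  where
  single : ∀ b → 1 + (b * 1 + 1) ≡ suc (suc b + 0)
  single = solve-∀
Dℕ-lower-tight (0 ∷ b ∷ B) =
  mk⇔ (λ eq → inj₂ (refl ∷ Dℕ-lower-tight⇒ (s≤s (s≤s z≤n)) (b ∷ B) eq))
      (λ { (inj₁ ()) ; (inj₂ (_ ∷ h)) → Dℕ-lower-tight⇐ (b ∷ B) h })
Dℕ-lower-tight (suc k ∷ b ∷ B) =
  mk⇔ (λ eq → contradiction eq (>⇒≢ strict)) (λ { (inj₁ ()) ; (inj₂ (() ∷ _)) })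
  where
  strict : suc (sum (map suc (suc k ∷ b ∷ B))) < Dℕ 1 1 (suc k ∷ b ∷ B)
  strict = ≤-<-trans (≤-reflexive (regroup k _))
             (Dℕ-lower-< (s≤s z≤n) (s≤s z≤n) b
                         (step-gain-<-by-e b (s≤s z≤n) (s≤s (m≤n+m 1 (k * 1)))) B)
    where
    regroup : ∀ k s → suc (suc (suc k) + s) ≡ 1 + (suc k * 1 + 1) + s
    regroup = solve-∀

index-step : ∀ b m s → b + suc m + s ≡ m + (suc b + s)
index-step = solve-∀

Dℕ-fib-≤ : ∀ m (B : Vec ℕ n) → Dℕ (fib (suc m)) (fib m) B ≤ fib (suc (m + sum (map suc B)))
Dℕ-fib-≤ m []      = ≤-reflexive (cong (fib ∘ suc) (sym (+-identityʳ m)))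
Dℕ-fib-≤ m (b ∷ B) = begin
  Dℕ (fib (suc m) + (b * fib (suc m) + fib m)) (b * fib (suc m) + fib m) B
    ≤⟨ Dℕ-mono-≤ (≤-trans (≤-reflexive (sym (+-assoc (fib (suc m)) _ _))) (fib-linear (suc b) m))
                 (fib-linear b m) B ⟩
  Dℕ (fib (suc (b + suc m))) (fib (b + suc m)) B  ≤⟨ Dℕ-fib-≤ (b + suc m) B ⟩
  fib (suc (b + suc m + sum (map suc B)))         ≡⟨ cong (fib ∘ suc) (index-step b m _) ⟩
  fib (suc (m + sum (map suc (b ∷ B))))           ∎
  where open ≤-Reasoning

Dℕ-fib-<-4+ : ∀ m k (B : Vec ℕ n) →
              Dℕ (fib (suc m)) (fib m) (2 + k ∷ B) < fib (suc (m + sum (map suc (2 + k ∷ B))))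
Dℕ-fib-<-4+ m k B = begin-strict
  Dℕ (fib (suc m) + ((2 + k) * fib (suc m) + fib m)) ((2 + k) * fib (suc m) + fib m) B
    <⟨ Dℕ-mono-<-≤ (≤-<-trans (≤-reflexive (sym (+-assoc (fib (suc m)) _ _))) (fib-linear-< k m))
                   (fib-linear (2 + k) m) B ⟩
  Dℕ (fib (suc m′)) (fib m′) B                ≤⟨ Dℕ-fib-≤ m′ B ⟩
  fib (suc (m′ + sum (map suc B)))            ≡⟨ cong (fib ∘ suc) (index-step (2 + k) m _) ⟩
  fib (suc (m + sum (map suc (2 + k ∷ B))))   ∎
  where
  open ≤-Reasoning
  m′ : ℕ
  m′ = 2 + k + suc m

Dℕ-fib-<-inner-2 : 1 ≤ m → ∀ b (B : Vec ℕ n) →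
                   Dℕ (fib (suc m)) (fib m) (0 ∷ b ∷ B)
                     < fib (suc (m + sum (map suc (0 ∷ b ∷ B))))
Dℕ-fib-<-inner-2 {m = m@(suc k)} _ b B = begin-strict
  Dℕ (fib (2 + m)) (fib m) (b ∷ B)             <⟨ Dℕ-mono-≤-< ≤-refl (fib-<-suc k) b B ⟩
  Dℕ (fib (2 + m)) (fib (suc m)) (b ∷ B)       ≤⟨ Dℕ-fib-≤ (suc m) (b ∷ B) ⟩
  fib (suc (suc m + sum (map suc (b ∷ B))))    ≡⟨ cong (fib ∘ suc) (index-step 0 m _) ⟩
  fib (suc (m + sum (map suc (0 ∷ b ∷ B))))    ∎
  where open ≤-Reasoning

Dℕ-fib-step-3 : ∀ m (B : Vec ℕ n) →
                Dℕ (fib (suc m)) (fib m) (1 ∷ B) ≡ Dℕ (fib (3 + m)) (fib (2 + m)) B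
Dℕ-fib-step-3 m B =
  cong₂ (λ c e → Dℕ c e B) (next-c (fib (suc m)) (fib m)) (next-e (fib (suc m)) (fib m))
  where
  next-c : ∀ x y → x + (1 * x + y) ≡ x + y + x
  next-c = solve-∀
  next-e : ∀ x y → 1 * x + y ≡ x + y
  next-e = solve-∀

-- At m = 0 an entry 2 followed by further entries would also be tight, since fib 0 = fib 1.
Dℕ-fib-tight : ∀ m → 1 ≤ m → (B : Vec ℕ n) →
               Dℕ (fib (suc m)) (fib m) B ≡ fib (suc (m + sum (map suc B)))
                 ⇔ ThreesThen≤3 (map (2 ℕ.+_) B)
Dℕ-fib-tight m _ [] = mk⇔ (λ _ → tt) (λ _ → cong (fib ∘ suc) (sym (+-identityʳ m)))
Dℕ-fib-tight m _ (0 ∷ []) = mk⇔ (λ _ → s≤s (s≤s z≤n)) (λ _ → cong (fib ∘ suc) (+-comm 1 m))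
Dℕ-fib-tight m 1≤m (0 ∷ b ∷ B) =
  mk⇔ (λ eq → contradiction eq (<⇒≢ (Dℕ-fib-<-inner-2 1≤m b B))) (λ { (() , _) })
Dℕ-fib-tight m _ (1 ∷ B) =
  ⇔-trans (mk⇔ (subst₂ _≡_ step index) (subst₂ _≡_ (sym step) (sym index)))
          (⇔-trans (Dℕ-fib-tight (2 + m) (s≤s z≤n) B) ThreesThen≤3-3∷)
  where
  step : Dℕ (fib (suc m)) (fib m) (1 ∷ B) ≡ Dℕ (fib (3 + m)) (fib (2 + m)) B
  step = Dℕ-fib-step-3 m B
  index : fib (suc (m + sum (map suc (1 ∷ B)))) ≡ fib (suc (2 + m + sum (map suc B)))
  index = cong (fib ∘ suc) (sym (index-step 1 m _))
Dℕ-fib-tight m _ (suc (suc k) ∷ B) =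
  mk⇔ (λ eq → contradiction eq (<⇒≢ (Dℕ-fib-<-4+ m k B)))
      (λ t → contradiction (ThreesThen≤3-head t) λ { (s≤s (s≤s (s≤s ()))) })

Dℕ-upper-tight : (B : Vec ℕ (suc n)) →
                 Dℕ 1 1 B ≡ fib (suc (sum (map suc B)))
                   ⇔ (head (map (2 ℕ.+_) B) ≤ 3 × ThreesThen≤3 (tail (map (2 ℕ.+_) B)))
Dℕ-upper-tight (0 ∷ B) = ⇔-trans (Dℕ-fib-tight 1 (s≤s z≤n) B) (mk⇔ (s≤s (s≤s z≤n) ,_) proj₂)
Dℕ-upper-tight (1 ∷ B) = ⇔-trans (Dℕ-fib-tight 2 (s≤s z≤n) B) (mk⇔ (≤-refl ,_) proj₂)
Dℕ-upper-tight (suc (suc k) ∷ B) =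
  mk⇔ (λ eq → contradiction eq (<⇒≢ (Dℕ-fib-<-4+ 0 k B))) (λ { (s≤s (s≤s (s≤s ())) , _) })

lemma4p1 : (n : ℕ) → (A : Vec ℕ (suc n)) → (∀ i → 2 ≤ lookup A i) →
    let q = suc n
        d = sum A ∸ q
    in (+ (suc d) ≤ℤ D (toList A))
       × (D (toList A) ≤ℤ + fib (suc d))
       × (D (toList A) ≡ + (suc d) ⇔ (q ≡ 1 ⊎ (∀ i → lookup A i ≡ 2)))
       × (D (toList A) ≡ + fib (suc d) ⇔
           (head A ≤ 3 × last A ≤ 3
             × (∀ (i : Fin q) → 0 < toℕ i → toℕ i < n → lookup A i ≡ 3)))
lemma4p1 n A h with excesses (lookup⁻ {xs = A} h)
... | B , refl rewrite sum-map-2+∸length B | D≡Dℕ B =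
    +≤+ (Dℕ-lower (s≤s z≤n) (s≤s z≤n) B)
  , +≤+ (Dℕ-fib-≤ 0 B)
  , ⇔-trans +-injective⇔ (⇔-trans (Dℕ-lower-tight B) (⇔-refl ⊎-⇔ mk⇔ lookup⁺ lookup⁻))
  , ⇔-trans +-injective⇔
            (⇔-trans (Dℕ-upper-tight B) (head-ThreesThen≤3-tail⇔ (map (2 ℕ.+_) B)))
  where
  +-injective⇔ : ∀ {x y} → (+ x ≡ + y) ⇔ (x ≡ y)
  +-injective⇔ = mk⇔ ℤ.+-injective (cong (λ x → + x))
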